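{- Let $G$ be a graph and let $S\subseteq E(G)$ be an inclusion-minimal set of edges with $\alpha(G/S)<\alpha(G)$. Then the graph $G|_S$ (vertex set $V(G)$, edge set $S$) is a forest.
   Context: All graphs are finite and simple. $\alpha$ denotes the independence number. For $S\subseteq E(G)$, the contraction $G/S$ is the graph whose vertices correspond to the connected components of $G|_S$, two vertices being adjacent iff the corresponding components $A,B$ satisfy $\mathrm{dist}_G(V(A),V(B))=1$. -}

module Defs where

open import Data.Nat using (ℕ; zero; suc; _<_)
open import Data.Fin using (Fin; zero; suc; inject₁; fromℕ)
open import Data.Bool using (Bool; true; false)
open import Data.Product using (Σ; ∃; _×_; _,_)
open import Relation.Binary.PropositionalEquality using (_≡_; _≢_)
open import Relation.Nullary using (¬_)
open import Function.Definitions using (Injective)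

record Graph (n : ℕ) : Set where
  field
    adj     : Fin n → Fin n → Bool
    adj-sym : ∀ u v → adj u v ≡ adj v u
    irrefl  : ∀ v → adj v v ≡ false
open Graph public

EdgeSet : ℕ → Set
EdgeSet n = Fin n → Fin n → Bool

IsSymmetric : ∀ {n} → EdgeSet n → Set
IsSymmetric S = ∀ u v → S u v ≡ S v u

_⊆E_ : ∀ {n} → EdgeSet n → Graph n → Set
S ⊆E G = IsSymmetric S × (∀ u v → S u v ≡ true → adj G u v ≡ true)

_⊆S_ : ∀ {n} → EdgeSet n → EdgeSet n → Set
S' ⊆S S = ∀ u v → S' u v ≡ true → S u v ≡ true

_⊊S_ : ∀ {n} → EdgeSet n → EdgeSet n → Set
S' ⊊S S = (S' ⊆S S) × ∃ λ u → ∃ λ v → S u v ≡ true × S' u v ≡ false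

data Conn {n : ℕ} (S : EdgeSet n) : Fin n → Fin n → Set where
  here : ∀ {u} → Conn S u u
  step : ∀ {u v w} → S u v ≡ true → Conn S v w → Conn S u w

HasIndepSet : ∀ {n} → Graph n → ℕ → Set
HasIndepSet {n} G k =
  Σ (Fin k → Fin n) λ f → Injective _≡_ _≡_ f ×
    (∀ i j → adj G (f i) (f j) ≡ false)

IsIndepNumber : ∀ {n} → Graph n → ℕ → Set
IsIndepNumber G k = HasIndepSet G k × ¬ HasIndepSet G (suc k)

-- Independent sets of size k in the contraction G/S: k pairwise distinct
-- components of G|_S (given by representatives f i), no two of which are
-- adjacent in G/S, i.e. at G-distance 1 (there is no G-edge x y with x in
-- the component of f i and y in the component of f j, for i ≢ j).
HasIndepSetContr : ∀ {n} → Graph n → EdgeSet n → ℕ → Set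
HasIndepSetContr {n} G S k =
  Σ (Fin k → Fin n) λ f →
    (∀ i j → i ≢ j → ¬ Conn S (f i) (f j)) ×
    (∀ i j → i ≢ j → ∀ x y → Conn S (f i) x → Conn S (f j) y →
       adj G x y ≡ false)

IsIndepNumberContr : ∀ {n} → Graph n → EdgeSet n → ℕ → Set
IsIndepNumberContr G S k =
  HasIndepSetContr G S k × ¬ HasIndepSetContr G S (suc k)

ContrDropsAlpha : ∀ {n} → Graph n → EdgeSet n → Set
ContrDropsAlpha G S =
  ∃ λ a → ∃ λ b → IsIndepNumberContr G S a × IsIndepNumber G b × a < b

-- A cycle in G|_S: distinct vertices v_0,…,v_{m+2} (length ≥ 3) with
-- v_i v_{i+1} ∈ S and v_{m+2} v_0 ∈ S.
HasCycle : ∀ {n} → EdgeSet n → Set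
HasCycle {n} S =
  ∃ λ m → Σ (Fin (suc (suc (suc m))) → Fin n) λ f →
    Injective _≡_ _≡_ f ×
    (∀ (i : Fin (suc (suc m))) → S (f (inject₁ i)) (f (suc i)) ≡ true) ×
    S (f (fromℕ (suc (suc m)))) (f zero) ≡ true

IsForest : ∀ {n} → EdgeSet n → Set
IsForest S = ¬ HasCycle S

{-# OPTIONS --safe #-}
-- A cycle of G|_S contains an edge ab whose endpoints stay connected by the rest of the
-- cycle, so S − {ab} has the same components as S, hence the same contraction G/S and
-- the same α(G/S): the smaller edge set still lowers α, contradicting minimality.
module Submission where

open import Defs
open import Data.Nat using (ℕ; zero; suc)
open import Data.Fin using (Fin; zero; suc; inject₁; fromℕ; _≟_)
open import Data.Fin.Properties using (fromℕ≢inject₁; suc-injective)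
open import Data.Bool using (true; false; _∧_; not)
open import Data.Product using (_×_; _,_)
open import Data.Sum using (_⊎_; inj₁; inj₂)
open import Function.Bundles using (mk⇔)
open import Function.Definitions using (Injective)
open import Relation.Binary.PropositionalEquality using (_≡_; _≢_; refl; sym; trans; cong₂)
open import Relation.Nullary using (¬_; Dec; yes; no; does)
open import Relation.Nullary.Decidable using (_×-dec_; _⊎-dec_; does-⇔; dec-true; dec-false)

module _ {n : ℕ} where

  Conn-trans : ∀ {S : EdgeSet n} {x y z} → Conn S x y → Conn S y z → Conn S x z
  Conn-trans here      q = q
  Conn-trans (step e p) q = step e (Conn-trans p q)

  Conn-sym : ∀ {S : EdgeSet n} → IsSymmetric S → ∀ {x y} → Conn S x y → Conn S y x
  Conn-sym sym-S here               = here
  Conn-sym sym-S (step {u} {v} e p) = Conn-trans (Conn-sym sym-S p) (step (trans (sym-S v u) e) here)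

  Conn-mono : ∀ {S T : EdgeSet n} → S ⊆S T → ∀ {x y} → Conn S x y → Conn T x y
  Conn-mono S⊆T here               = here
  Conn-mono S⊆T (step {u} {v} e p) = step (S⊆T u v e) (Conn-mono S⊆T p)

  Conn-walk : ∀ {S : EdgeSet n} k (g : Fin (suc k) → Fin n) →
    (∀ (i : Fin k) → S (g (inject₁ i)) (g (suc i)) ≡ true) → Conn S (g zero) (g (fromℕ k))
  Conn-walk zero    g e = here
  Conn-walk (suc k) g e = step (e zero) (Conn-walk k (λ i → g (suc i)) (λ i → e (suc i)))

  HasIndepSetContr-anti : ∀ (G : Graph n) {S T : EdgeSet n} {k} →
    (∀ {x y} → Conn T x y → Conn S x y) → HasIndepSetContr G S k → HasIndepSetContr G T k
  HasIndepSetContr-anti G T⇒S (f , distinct , indep) =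
    f , (λ i j i≢j c → distinct i j i≢j (T⇒S c))
      , (λ i j i≢j x y cx cy → indep i j i≢j x y (T⇒S cx) (T⇒S cy))

  ContrDropsAlpha-resp-Conn : ∀ (G : Graph n) {S T : EdgeSet n} →
    (∀ {x y} → Conn S x y → Conn T x y) → (∀ {x y} → Conn T x y → Conn S x y) →
    ContrDropsAlpha G S → ContrDropsAlpha G T
  ContrDropsAlpha-resp-Conn G S⇒T T⇒S (a , b , (indepS , noLargerS) , αG , a<b) =
    a , b , (HasIndepSetContr-anti G T⇒S indepS , λ larger → noLargerS (HasIndepSetContr-anti G S⇒T larger))
      , αG , a<b

  SameEdge : Fin n → Fin n → Fin n → Fin n → Set
  SameEdge a b u v = (u ≡ a × v ≡ b) ⊎ (u ≡ b × v ≡ a)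

  sameEdge? : ∀ a b u v → Dec (SameEdge a b u v)
  sameEdge? a b u v = (u ≟ a ×-dec v ≟ b) ⊎-dec (u ≟ b ×-dec v ≟ a)

  removeEdge : Fin n → Fin n → EdgeSet n → EdgeSet n
  removeEdge a b S u v = not (does (sameEdge? a b u v)) ∧ S u v

  module _ (a b : Fin n) (S : EdgeSet n) where

    removeEdge-sym : IsSymmetric S → IsSymmetric (removeEdge a b S)
    removeEdge-sym sym-S u v =
      cong₂ (λ p q → not p ∧ q) (does-⇔ (mk⇔ flip flip) (sameEdge? a b u v) (sameEdge? a b v u)) (sym-S u v)
      where
      flip : ∀ {x y} → SameEdge a b x y → SameEdge a b y x
      flip (inj₁ (x≡a , y≡b)) = inj₂ (y≡b , x≡a)
      flip (inj₂ (x≡b , y≡a)) = inj₁ (y≡a , x≡b)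

    removeEdge-⊆ : removeEdge a b S ⊆S S
    removeEdge-⊆ u v h with does (sameEdge? a b u v)
    ... | false = h

    removeEdge-removes : ∀ u v → SameEdge a b u v → removeEdge a b S u v ≡ false
    removeEdge-removes u v same rewrite dec-true (sameEdge? a b u v) same = refl

    removeEdge-keeps : ∀ u v → ¬ SameEdge a b u v → S u v ≡ true → removeEdge a b S u v ≡ true
    removeEdge-keeps u v other h rewrite dec-false (sameEdge? a b u v) other = h

    Conn-removeEdge : IsSymmetric S → Conn (removeEdge a b S) a b →
      ∀ {x y} → Conn S x y → Conn (removeEdge a b S) x y
    Conn-removeEdge sym-S a~b here = here
    Conn-removeEdge sym-S a~b (step {u} {v} e p) with sameEdge? a b u v
    ... | yes (inj₁ (refl , refl)) = Conn-trans a~b (Conn-removeEdge sym-S a~b p)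
    ... | yes (inj₂ (refl , refl)) =
      Conn-trans (Conn-sym (removeEdge-sym sym-S) a~b) (Conn-removeEdge sym-S a~b p)
    ... | no other = step (removeEdge-keeps u v other e) (Conn-removeEdge sym-S a~b p)

  walkEdge-≢-closingEdge : ∀ m (f : Fin (suc (suc (suc m))) → Fin n) → Injective _≡_ _≡_ f →
    ∀ (i : Fin (suc (suc m))) → ¬ SameEdge (f zero) (f (fromℕ (suc (suc m)))) (f (inject₁ i)) (f (suc i))
  walkEdge-≢-closingEdge m f inj i (inj₁ (start , end)) =
    lastStep-≢-firstStep i (suc-injective (inj end)) (inj start)
    where
    lastStep-≢-firstStep : ∀ {k} (j : Fin (suc (suc k))) → j ≡ fromℕ (suc k) → inject₁ j ≢ zero
    lastStep-≢-firstStep zero    () refl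
    lastStep-≢-firstStep (suc j) _  ()
  walkEdge-≢-closingEdge m f inj i (inj₂ (end , _)) = fromℕ≢inject₁ (sym (inj end))

mainTheorem5 : ∀ {n : ℕ} (G : Graph n) (S : EdgeSet n) →
    S ⊆E G →
    ContrDropsAlpha G S →
    (∀ (S' : EdgeSet n) → IsSymmetric S' → S' ⊊S S → ¬ ContrDropsAlpha G S') →
    IsForest S
mainTheorem5 G S (sym-S , _) drops minimal (m , f , inj , walk , closing) =
  minimal S′ (removeEdge-sym a b S sym-S)
    (removeEdge-⊆ a b S , b , a , closing , removeEdge-removes a b S b a (inj₂ (refl , refl)))
    (ContrDropsAlpha-resp-Conn G (Conn-removeEdge a b S sym-S a~b) (Conn-mono (removeEdge-⊆ a b S)) drops)
  where
  a b : Fin _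
  a = f zero
  b = f (fromℕ (suc (suc m)))
  S′ : EdgeSet _
  S′ = removeEdge a b S
  a~b : Conn S′ a b
  a~b = Conn-walk (suc (suc m)) f λ i →
    removeEdge-keeps a b S _ _ (walkEdge-≢-closingEdge m f inj i) (walk i)
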